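{- Let $a$ and $d$ be positive integers and let $n\ge 0$ be an integer. Then there exists an oriented bipartite graph with score set $A=\{a, a+d, a+2d,\dots, a+nd\}$.
   Context: An oriented bipartite graph $D(U,V)$ is obtained by assigning a direction to each edge of a simple bipartite graph with parts $U=\{u_1,\dots,u_m\}$ and $V=\{v_1,\dots,v_n\}$. For a vertex $x$, let $d_x^+$ and $d_x^-$ denote its outdegree and indegree. The score of $u\in U$ is $a_u=n+d_u^+-d_u^-$ and the score of $v\in V$ is $b_v=m+d_v^+-d_v^-$. The score set of $D(U,V)$ is the set of distinct scores of all its vertices. -}

module Defs where

open import Data.Nat using (ℕ; _≤_)
open import Data.Integer using (ℤ; +_; _+_; _-_; _*_)
open import Data.Fin using (Fin)
open import Data.List using (List; length; filter)
open import Data.List using () renaming (allFin to finList)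
open import Data.Product using (Σ; ∃; _×_; _,_)
open import Data.Sum using (_⊎_)
open import Relation.Binary.PropositionalEquality using (_≡_; _≢_; refl)
open import Relation.Nullary using (Dec; yes; no)

-- The state of a pair {u_i , v_j} in an oriented bipartite graph:
-- no edge, an arc u_i → v_j, or an arc v_j → u_i.
-- (Simple underlying graph: at most one edge per pair, oriented one way.)
data Arc : Set where
  none  : Arc
  u⇒v   : Arc
  v⇒u   : Arc

OBG : ℕ → ℕ → Set
OBG m n = Fin m → Fin n → Arc

isU⇒V : (x : Arc) → Dec (x ≡ u⇒v)
isU⇒V none = no (λ ())
isU⇒V u⇒v  = yes refl
isU⇒V v⇒u  = no (λ ())

isV⇒U : (x : Arc) → Dec (x ≡ v⇒u)
isV⇒U none = no (λ ())
isV⇒U u⇒v  = no (λ ())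
isV⇒U v⇒u  = yes refl

module _ {m n : ℕ} (D : OBG m n) where

  outU : Fin m → ℕ
  outU i = length (filter (λ j → isU⇒V (D i j)) (finList n))

  inU : Fin m → ℕ
  inU i = length (filter (λ j → isV⇒U (D i j)) (finList n))

  outV : Fin n → ℕ
  outV j = length (filter (λ i → isV⇒U (D i j)) (finList m))

  inV : Fin n → ℕ
  inV j = length (filter (λ i → isU⇒V (D i j)) (finList m))

  scoreU : Fin m → ℤ
  scoreU i = (+ n + + outU i) - + inU i

  scoreV : Fin n → ℤ
  scoreV j = (+ m + + outV j) - + inV j

  InScoreSet : ℤ → Set
  InScoreSet s = (Σ (Fin m) λ i → scoreU i ≡ s) ⊎ (Σ (Fin n) λ j → scoreV j ≡ s)

InAP : ℤ → ℤ → ℕ → ℤ → Set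
InAP a d k s = Σ ℕ λ t → (t ≤ k) × (s ≡ a + + t * d)

{-# OPTIONS --safe #-}

-- Cut U and V into blocks of d consecutive vertices and orient an edge u → v
-- exactly when block(u) + block(v) < K.  All arcs point into V, and a vertex in
-- block x has degree (K ∸ x)·d, so the U-scores are a + (M + (K ∸ x))·d and the
-- V-scores a + (K ∸ (K ∸ x))·d.  With |U| = a + K·d and |V| = a + M·d the a ≥ 1
-- surplus vertices on each side realise x ≥ K, so U yields the terms M … M + K and
-- V the terms 0 … K of the progression; taking K + M = n with K ≤ M ≤ K + 1 makes
-- these two ranges cover 0 … n.

module Submission where

open import Defs
open import Data.Nat using (ℕ)
open import Data.Integer using (ℤ; _>_; +_)
open import Data.Product using (Σ; _×_)
open import Function.Bundles using (_⇔_)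

open import Level using (Level; 0ℓ)
open import Data.Bool using (true; false)
open import Data.Nat
  using (zero; suc; _+_; _*_; _∸_; _≤_; _<_; z≤n; s≤s; z<s; s<s; s<s⁻¹; _≤?_; _<?_; NonZero; >-nonZero⁻¹)
open import Data.Nat.Properties
open import Data.Nat.DivMod using (_/_; _%_; m≡m%n+[m/n]*n; m%n<n; m<n*o⇒m/o<n; m*n/n≡m)
open import Data.Integer using (-[1+_]; +<+; _⊖_) renaming (_+_ to _+ℤ_; _-_ to _-ℤ_; _*_ to _*ℤ_)
open import Data.Integer.Properties using (pos-*; m-n≡m⊖n; ⊖-≥)
open import Data.Fin using (Fin; toℕ; fromℕ<)
import Data.Fin as Fin
open import Data.Fin.Properties using (toℕ-fromℕ<)
open import Data.List using (List; []; _∷_; length; filter; map; tabulate; allFin)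
open import Data.List.Properties
  using (filter-accept; filter-none; filter-≐; length-filter; length-tabulate; map-tabulate)
import Data.List.Relation.Unary.All as All
open import Data.Product using (_,_)
open import Data.Sum using (inj₁; inj₂)
open import Function using (id; _∘_)
open import Function.Bundles using (mk⇔; Equivalence)
import Function.Properties.Equivalence as ⇔
open import Relation.Nullary using (Dec; yes; no; does; contradiction)
open import Relation.Unary using (Pred; Decidable)
import Relation.Binary as B
open import Relation.Binary.PropositionalEquality
  using (_≡_; _≢_; refl; sym; trans; cong; subst; module ≡-Reasoning)

private
  variable
    ℓ : Level
    A B : Set

length-filter-map : {P : Pred B ℓ} (P? : Decidable P) (f : A → B) (xs : List A) →
                    length (filter P? (map f xs)) ≡ length (filter (P? ∘ f) xs)
length-filter-map P? f []       = refl
length-filter-map P? f (x ∷ xs) with does (P? (f x))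
... | true  = cong suc (length-filter-map P? f xs)
... | false = length-filter-map P? f xs

length-filter-allFin-< : ∀ {N h} {P : Pred (Fin N) ℓ} (P? : Decidable P) → h ≤ N →
                         (∀ k → P k ⇔ toℕ k < h) → length (filter P? (allFin N)) ≡ h
length-filter-allFin-< P? z≤n P⇔ =
  cong length (filter-none P? {allFin _} (All.universal (λ k → (λ ()) ∘ Equivalence.to (P⇔ k)) _))
length-filter-allFin-< {N = suc N} {h = suc h} {P = P} P? (s≤s h≤N) P⇔ = begin
  length (filter P? (allFin (suc N)))               ≡⟨ cong length (filter-accept P? P[0]) ⟩
  suc (length (filter P? (tabulate Fin.suc)))       ≡⟨ cong (suc ∘ length ∘ filter P?) (sym (map-tabulate id Fin.suc)) ⟩
  suc (length (filter P? (map Fin.suc (allFin N)))) ≡⟨ cong suc (length-filter-map P? Fin.suc (allFin N)) ⟩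
  suc (length (filter (P? ∘ Fin.suc) (allFin N)))   ≡⟨ cong suc (length-filter-allFin-< (P? ∘ Fin.suc) h≤N P∘suc⇔) ⟩
  suc h                                             ∎
  where
  open ≡-Reasoning
  P[0] : P Fin.zero
  P[0] = Equivalence.from (P⇔ Fin.zero) z<s
  P∘suc⇔ : ∀ k → P (Fin.suc k) ⇔ toℕ k < h
  P∘suc⇔ k = ⇔.trans (P⇔ (Fin.suc k)) (mk⇔ s<s⁻¹ s<s)

m/n<o⇒m<o*n : ∀ {m n o} .{{_ : NonZero n}} → m / n < o → m < o * n
m/n<o⇒m<o*n {m} {n} {o} m/n<o = begin-strict
  m                 ≡⟨ m≡m%n+[m/n]*n m n ⟩
  m % n + m / n * n <⟨ +-monoˡ-< (m / n * n) (m%n<n m n) ⟩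
  suc (m / n) * n   ≤⟨ *-monoˡ-≤ n m/n<o ⟩
  o * n             ∎
  where open ≤-Reasoning

/-+-<⇔ : ∀ x y k {d} .{{_ : NonZero d}} → x / d + y / d < k ⇔ x < (k ∸ y / d) * d
/-+-<⇔ x y k {d} = mk⇔
  (λ lt → m/n<o⇒m<o*n (m+n≤o⇒m≤o∸n (suc (x / d)) lt))
  (λ lt → let x/d<k∸y/d = m<n*o⇒m/o<n lt in
    m≤o∸n⇒m+n≤o (suc (x / d)) (<⇒≤ (m∸n≢0⇒n<m (m<n⇒n≢0 x/d<k∸y/d))) x/d<k∸y/d)

arcIf : {P : Set ℓ} → Dec P → Arc
arcIf (yes _) = u⇒v
arcIf (no _)  = none

module _ {P : Set ℓ} where

  arcIf≡u⇒v⇒ : (P? : Dec P) → arcIf P? ≡ u⇒v → P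
  arcIf≡u⇒v⇒ (yes p) refl = p

  arcIf≡u⇒v⇐ : (P? : Dec P) → P → arcIf P? ≡ u⇒v
  arcIf≡u⇒v⇐ (yes _) _  = refl
  arcIf≡u⇒v⇐ (no ¬p) p  = contradiction p ¬p

  arcIf≢v⇒u : (P? : Dec P) → arcIf P? ≢ v⇒u
  arcIf≢v⇒u (yes _) ()
  arcIf≢v⇒u (no _)  ()

module _ {p q : ℕ} {R : B.REL (Fin p) (Fin q) ℓ} (R? : B.Decidable R) where

  forward : OBG p q
  forward i j = arcIf (R? i j)

  outU-forward : ∀ i → outU forward i ≡ length (filter (R? i) (allFin q))
  outU-forward i = cong length (filter-≐ (λ j → isU⇒V (forward i j)) (R? i)
    ((λ {j} → arcIf≡u⇒v⇒ (R? i j)) , (λ {j} → arcIf≡u⇒v⇐ (R? i j))) (allFin q))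

  inV-forward : ∀ j → inV forward j ≡ length (filter (λ i → R? i j) (allFin p))
  inV-forward j = cong length (filter-≐ (λ i → isU⇒V (forward i j)) (λ i → R? i j)
    ((λ {i} → arcIf≡u⇒v⇒ (R? i j)) , (λ {i} → arcIf≡u⇒v⇐ (R? i j))) (allFin p))

  inU-forward : ∀ i → inU forward i ≡ 0
  inU-forward i = cong length (filter-none (λ j → isV⇒U (forward i j)) {allFin q}
    (All.universal (λ j → arcIf≢v⇒u (R? i j)) _))

  outV-forward : ∀ j → outV forward j ≡ 0
  outV-forward j = cong length (filter-none (λ i → isV⇒U (forward i j)) {allFin p}
    (All.universal (λ i → arcIf≢v⇒u (R? i j)) _))

  scoreU-forward : ∀ i → scoreU forward i ≡ + (q + outU forward i)
  scoreU-forward i = begin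
    (+ q +ℤ + outU forward i) -ℤ + inU forward i ≡⟨ cong (λ n → (+ q +ℤ + outU forward i) -ℤ + n) (inU-forward i) ⟩
    + (q + outU forward i + 0)                   ≡⟨ cong +_ (+-identityʳ _) ⟩
    + (q + outU forward i)                       ∎
    where open ≡-Reasoning

  scoreV-forward : ∀ j → scoreV forward j ≡ + (p ∸ inV forward j)
  scoreV-forward j = begin
    (+ p +ℤ + outV forward j) -ℤ + c ≡⟨ cong (λ o → (+ p +ℤ + o) -ℤ + c) (outV-forward j) ⟩
    + (p + 0) -ℤ + c                 ≡⟨ m-n≡m⊖n (p + 0) c ⟩
    (p + 0) ⊖ c                      ≡⟨ ⊖-≥ (≤-trans c≤p (m≤m+n p 0)) ⟩
    + (p + 0 ∸ c)                    ≡⟨ cong (λ x → + (x ∸ c)) (+-identityʳ p) ⟩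
    + (p ∸ c)                        ∎
    where
    open ≡-Reasoning
    c = inV forward j
    c≤p : c ≤ p
    c≤p = ≤-trans (length-filter (λ i → isU⇒V (forward i j)) (allFin p)) (≤-reflexive (length-tabulate id))

module Staircase (a d K M : ℕ) .{{_ : NonZero a}} .{{_ : NonZero d}}
                 (K≤M : K ≤ M) (M≤1+K : M ≤ suc K) where

  rank : ℕ → ℕ
  rank x = K ∸ x / d

  Adjacent : B.REL (Fin (a + K * d)) (Fin (a + M * d)) 0ℓ
  Adjacent i j = toℕ i / d + toℕ j / d < K

  adjacent? : B.Decidable Adjacent
  adjacent? i j = toℕ i / d + toℕ j / d <? K

  graph : OBG (a + K * d) (a + M * d)
  graph = forward adjacent?

  ap : ℕ → ℤ
  ap t = + a +ℤ + t *ℤ + d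

  pos-ap : ∀ t → + (a + t * d) ≡ ap t
  pos-ap t = cong (+ a +ℤ_) (pos-* t d)

  rank*d≤K*d : ∀ x → rank x * d ≤ K * d
  rank*d≤K*d x = *-monoˡ-≤ d (m∸n≤m K (x / d))

  rank-* : ∀ t → rank (t * d) ≡ K ∸ t
  rank-* t = cong (K ∸_) (m*n/n≡m t d)

  outU-graph : ∀ i → outU graph i ≡ rank (toℕ i) * d
  outU-graph i = trans (outU-forward adjacent? i) (length-filter-allFin-< _
    (≤-trans (rank*d≤K*d (toℕ i)) (≤-trans (*-monoˡ-≤ d K≤M) (m≤n+m (M * d) a)))
    (λ j → ⇔.trans (mk⇔ (subst (_< K) (+-comm (toℕ i / d) (toℕ j / d)))
                        (subst (_< K) (+-comm (toℕ j / d) (toℕ i / d))))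
                   (/-+-<⇔ (toℕ j) (toℕ i) K)))

  inV-graph : ∀ j → inV graph j ≡ rank (toℕ j) * d
  inV-graph j = trans (inV-forward adjacent? j) (length-filter-allFin-< _
    (≤-trans (rank*d≤K*d (toℕ j)) (m≤n+m (K * d) a))
    (λ i → /-+-<⇔ (toℕ i) (toℕ j) K))

  scoreU-graph : ∀ i → scoreU graph i ≡ ap (M + rank (toℕ i))
  scoreU-graph i = begin
    scoreU graph i              ≡⟨ scoreU-forward adjacent? i ⟩
    + (a + M * d + outU graph i) ≡⟨ cong (λ o → + (a + M * d + o)) (outU-graph i) ⟩
    + (a + M * d + r * d)       ≡⟨ cong +_ (trans (+-assoc a (M * d) (r * d)) (cong (λ x → a + x) (sym (*-distribʳ-+ d M r)))) ⟩
    + (a + (M + r) * d)         ≡⟨ pos-ap (M + r) ⟩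
    ap (M + r)                  ∎
    where
    open ≡-Reasoning
    r = rank (toℕ i)

  scoreV-graph : ∀ j → scoreV graph j ≡ ap (K ∸ rank (toℕ j))
  scoreV-graph j = begin
    scoreV graph j               ≡⟨ scoreV-forward adjacent? j ⟩
    + (a + K * d ∸ inV graph j)  ≡⟨ cong (λ n → + (a + K * d ∸ n)) (inV-graph j) ⟩
    + (a + K * d ∸ r * d)        ≡⟨ cong +_ (+-∸-assoc a (rank*d≤K*d (toℕ j))) ⟩
    + (a + (K * d ∸ r * d))      ≡⟨ cong (λ x → + (a + x)) (sym (*-distribʳ-∸ d K r)) ⟩
    + (a + (K ∸ r) * d)          ≡⟨ pos-ap (K ∸ r) ⟩
    ap (K ∸ r)                   ∎
    where
    open ≡-Reasoning
    r = rank (toℕ j)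

  scoreV-attains : ∀ {t} → t ≤ K → Σ (Fin (a + M * d)) λ j → scoreV graph j ≡ ap t
  scoreV-attains {t} t≤K = j , (begin
    scoreV graph j         ≡⟨ scoreV-graph j ⟩
    ap (K ∸ rank (toℕ j))  ≡⟨ cong (λ x → ap (K ∸ rank x)) (toℕ-fromℕ< t*d<q) ⟩
    ap (K ∸ rank (t * d))  ≡⟨ cong (λ x → ap (K ∸ x)) (rank-* t) ⟩
    ap (K ∸ (K ∸ t))       ≡⟨ cong ap (m∸[m∸n]≡n t≤K) ⟩
    ap t                   ∎)
    where
    open ≡-Reasoning
    t*d<q : t * d < a + M * d
    t*d<q = ≤-<-trans (*-monoˡ-≤ d (≤-trans t≤K K≤M)) (m<n+m (M * d) (>-nonZero⁻¹ a))
    j = fromℕ< t*d<q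

  scoreU-attains : ∀ {t} → M ≤ t → t ≤ K + M → Σ (Fin (a + K * d)) λ i → scoreU graph i ≡ ap t
  scoreU-attains {t} M≤t t≤K+M = i , (begin
    scoreU graph i                 ≡⟨ scoreU-graph i ⟩
    ap (M + rank (toℕ i))          ≡⟨ cong (λ x → ap (M + rank x)) (toℕ-fromℕ< [K∸s]*d<p) ⟩
    ap (M + rank ((K ∸ s) * d))    ≡⟨ cong (λ x → ap (M + x)) (rank-* (K ∸ s)) ⟩
    ap (M + (K ∸ (K ∸ s)))         ≡⟨ cong (λ x → ap (M + x)) (m∸[m∸n]≡n s≤K) ⟩
    ap (M + s)                     ≡⟨ cong ap (m+[n∸m]≡n M≤t) ⟩
    ap t                           ∎)
    where
    open ≡-Reasoning
    s = t ∸ M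
    s≤K : s ≤ K
    s≤K = m≤n+o⇒m∸n≤o t M (≤-trans t≤K+M (≤-reflexive (+-comm K M)))
    [K∸s]*d<p : (K ∸ s) * d < a + K * d
    [K∸s]*d<p = ≤-<-trans (*-monoˡ-≤ d (m∸n≤m K s)) (m<n+m (K * d) (>-nonZero⁻¹ a))
    i = fromℕ< [K∸s]*d<p

  scoreSet : ∀ s → InScoreSet graph s ⇔ InAP (+ a) (+ d) (K + M) s
  scoreSet s = mk⇔ to from
    where
    to : InScoreSet graph s → InAP (+ a) (+ d) (K + M) s
    to (inj₁ (i , refl)) = M + rank (toℕ i) ,
      ≤-trans (+-monoʳ-≤ M (m∸n≤m K (toℕ i / d))) (≤-reflexive (+-comm M K)) , scoreU-graph i
    to (inj₂ (j , refl)) = K ∸ rank (toℕ j) , ≤-trans (m∸n≤m K (K ∸ toℕ j / d)) (m≤m+n K M) , scoreV-graph j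

    from : InAP (+ a) (+ d) (K + M) s → InScoreSet graph s
    from (t , t≤K+M , refl) with t ≤? K
    ... | yes t≤K = inj₂ (scoreV-attains t≤K)
    ... | no  t≰K = inj₁ (scoreU-attains (≤-trans M≤1+K (≰⇒> t≰K)) t≤K+M)

balancedSplit : ∀ n → Σ ℕ λ K → Σ ℕ λ M → K ≤ M × M ≤ suc K × K + M ≡ n
balancedSplit zero          = 0 , 0 , z≤n , z≤n , refl
balancedSplit (suc zero)    = 0 , 1 , z≤n , s≤s z≤n , refl
balancedSplit (suc (suc n)) with K , M , K≤M , M≤1+K , refl ← balancedSplit n =
  suc K , suc M , s≤s K≤M , s≤s M≤1+K , cong suc (+-suc K M)

theorem2p4 : (a d : ℤ) → a > + 0 → d > + 0 → (n : ℕ) →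
    Σ ℕ λ p → Σ ℕ λ q → Σ (OBG p q) λ D →
      (s : ℤ) → InScoreSet D s ⇔ InAP a d n s
theorem2p4 (+ zero)      _             (+<+ ()) _        _
theorem2p4 -[1+ _ ]      _             ()       _        _
theorem2p4 (+ suc _)     (+ zero)      _        (+<+ ()) _
theorem2p4 (+ suc _)     -[1+ _ ]      _        ()       _
theorem2p4 (+ a@(suc _)) (+ d@(suc _)) _        _        n
  with K , M , K≤M , M≤1+K , refl ← balancedSplit n =
  a + K * d , a + M * d , graph , scoreSet
  where open Staircase a d K M K≤M M≤1+K
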